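{- Let $G$ be a connected finite simple graph of order $n$ with maximum degree $\Delta(G)\geq n-2$. Then $\chi_{md}(G)=\chi(G)$.
   Context: For a vertex $v$, $N[v]=N(v)\cup\{v\}$; $v$ dominates exactly the vertices of $N[v]$. A majority dominator coloring of $G$ is a proper vertex coloring such that for every vertex $v$ there is a color class $C$ with $|N[v]\cap C|\geq |C|/2$. $\chi_{md}(G)$ is the minimum number of color classes in a majority dominator coloring of $G$; $\chi(G)$ is the chromatic number. -}

module Defs where

open import Data.Nat using (ℕ; zero; suc; _+_; _*_; _≤_; _<_; _≥_; _∸_)
open import Data.Fin using (Fin)
open import Data.Bool using (Bool; true; false; _∨_; _∧_; if_then_else_)
open import Data.List using (List; []; _∷_; length; filter)
open import Data.List using (allFin)
open import Data.Product using (Σ; ∃; _×_; _,_)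
open import Relation.Binary.PropositionalEquality using (_≡_; _≢_)
open import Relation.Nullary using (¬_)
open import Relation.Nullary.Decidable using (⌊_⌋)
open import Data.Fin using (_≟_)
open import Function.Definitions using (Surjective)

record Graph (n : ℕ) : Set where
  field
    adj   : Fin n → Fin n → Bool
    sym   : ∀ u v → adj u v ≡ adj v u
    irrefl : ∀ v → adj v v ≡ false
open Graph public

count : {n : ℕ} → (Fin n → Bool) → ℕ
count {n} p = length (filter (λ v → p v ≡? true) (allFin n))
  where
  open import Data.Bool using () renaming (_≟_ to _≡?_)

degree : {n : ℕ} → Graph n → Fin n → ℕ
degree G v = count (adj G v)

MaxDegreeAtLeast : {n : ℕ} → Graph n → ℕ → Set
MaxDegreeAtLeast G d = ∃ λ v → degree G v ≥ d

inClosedNbhd : {n : ℕ} → Graph n → Fin n → Fin n → Bool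
inClosedNbhd G v u = ⌊ u ≟ v ⌋ ∨ adj G v u

data Walk {n : ℕ} (G : Graph n) : Fin n → Fin n → Set where
  here : ∀ {u} → Walk G u u
  step : ∀ {u v w} → adj G u v ≡ true → Walk G v w → Walk G u w

Connected : {n : ℕ} → Graph n → Set
Connected G = ∀ u v → Walk G u v

-- colorings with k colors; color classes are required to be nonempty
-- (surjective coloring), i.e. exactly k color classes
IsProperColoring : {n k : ℕ} → Graph n → (Fin n → Fin k) → Set
IsProperColoring G c = ∀ u v → adj G u v ≡ true → c u ≢ c v

IsColoringWithClasses : {n k : ℕ} → Graph n → (Fin n → Fin k) → Set
IsColoringWithClasses G c = IsProperColoring G c × Surjective _≡_ _≡_ c

inClass : {n k : ℕ} → (Fin n → Fin k) → Fin k → Fin n → Bool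
inClass c i u = ⌊ c u ≟ i ⌋

classSize : {n k : ℕ} → (Fin n → Fin k) → Fin k → ℕ
classSize c i = count (inClass c i)

nbhdInClass : {n k : ℕ} → Graph n → (Fin n → Fin k) → Fin n → Fin k → ℕ
nbhdInClass G c v i = count (λ u → inClosedNbhd G v u ∧ inClass c i u)

-- every vertex v has a class C with |N[v] ∩ C| ≥ |C|/2, i.e. 2|N[v]∩C| ≥ |C|
IsMajorityDominatorColoring : {n k : ℕ} → Graph n → (Fin n → Fin k) → Set
IsMajorityDominatorColoring G c =
  IsColoringWithClasses G c ×
  (∀ v → ∃ λ i → 2 * nbhdInClass G c v i ≥ classSize c i)

IsChromaticNumber : {n : ℕ} → Graph n → ℕ → Set
IsChromaticNumber {n} G k =
  (Σ (Fin n → Fin k) λ c → IsColoringWithClasses G c) ×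
  (∀ j → j < k → ¬ Σ (Fin n → Fin j) λ c → IsColoringWithClasses G c)

IsMajorityDominatorChromaticNumber : {n : ℕ} → Graph n → ℕ → Set
IsMajorityDominatorChromaticNumber {n} G k =
  (Σ (Fin n → Fin k) λ c → IsMajorityDominatorColoring G c) ×
  (∀ j → j < k → ¬ Σ (Fin n → Fin j) λ c → IsMajorityDominatorColoring G c)

-- A vertex v of degree at least n − 2 has at most one non-neighbour u ≠ v.
-- So in a proper colouring the class of v lies inside {v, u}, and every vertex
-- other than u has v in its closed neighbourhood; a class of size at most two
-- is majority dominated by every vertex whose closed neighbourhood meets it.
-- Starting from a colouring with χ(G) classes: if u is alone in its class, u
-- uses that class and all other vertices use the class of v; otherwise
-- recolour u with the colour of v, which keeps all χ(G) classes and makes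
-- {v, u} a class met by every closed neighbourhood. Conversely a majority
-- dominator colouring is proper, so it cannot use fewer than χ(G) colours.
module Submission where

open import Defs hiding (sym)
open import Data.Nat using (ℕ; zero; suc; _+_; _*_; _∸_; _≤_; _≥_; z≤n; s≤s)
open import Data.Nat.Properties
  using (≤-trans; ≤-reflexive; +-suc; +-comm; +-mono-≤; *-monoʳ-≤; m≤n+m∸n; m≤n⇒m≤1+n; <-irrefl)
open import Data.Fin using (Fin; zero; suc; _≟_)
open import Data.Fin.Properties using (any?)
open import Data.Bool using (Bool; true; false; not; _∧_; if_then_else_)
open import Data.Bool using () renaming (_≟_ to _≟ᵇ_)
open import Data.Bool.Properties using (∧-identityʳ)
open import Data.List using (List; []; _∷_; length; filter; tabulate)
open import Data.List.Membership.Propositional using (_∈_)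
open import Data.List.Relation.Unary.Any using (here; there)
open import Data.List.Relation.Unary.All as All using ([]; _∷_)
open import Data.List.Relation.Unary.AllPairs using ([]; _∷_)
open import Data.List.Relation.Unary.Unique.Propositional using (Unique)
open import Data.Product using (Σ; ∃; _×_; _,_; proj₁; proj₂)
open import Data.Sum using (_⊎_; inj₁; inj₂; [_,_]′)
open import Data.Empty using (⊥; ⊥-elim)
open import Function using (_∘_; id)
open import Function.Definitions using (Surjective)
open import Relation.Binary.PropositionalEquality
open import Relation.Nullary using (¬_; Dec; yes; no)
open import Relation.Nullary.Decidable
  using (⌊_⌋; ¬?; _×-dec_; dec-true; dec-false; isYes≗does; ⌊⌋-map′)

⌊⌋-yes : ∀ {a} {A : Set a} (a? : Dec A) → A → ⌊ a? ⌋ ≡ true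
⌊⌋-yes a? a = trans (isYes≗does a?) (dec-true a? a)

⌊⌋-no : ∀ {a} {A : Set a} (a? : Dec A) → ¬ A → ⌊ a? ⌋ ≡ false
⌊⌋-no a? ¬a = trans (isYes≗does a?) (dec-false a? ¬a)

⌊⌋-sound : ∀ {a} {A : Set a} (a? : Dec A) → ⌊ a? ⌋ ≡ true → A
⌊⌋-sound (yes a) _ = a

count-tabulate : ∀ {m n} (p : Fin m → Bool) (f : Fin n → Fin m) →
  length (filter (λ x → p x ≟ᵇ true) (tabulate f)) ≡ count (p ∘ f)
count-tabulate {n = zero} p f = refl
count-tabulate {n = suc n} p f with p (f zero)
... | true  = cong suc (trans (count-tabulate p (f ∘ suc)) (sym (count-tabulate (p ∘ f) suc)))
... | false = trans (count-tabulate p (f ∘ suc)) (sym (count-tabulate (p ∘ f) suc))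

count-suc : ∀ {n} (p : Fin (suc n) → Bool) →
  count p ≡ (if p zero then suc else id) (count (p ∘ suc))
count-suc p with p zero
... | true  = cong suc (count-tabulate p suc)
... | false = count-tabulate p suc

count-cong : ∀ {n} {p q : Fin n → Bool} → (∀ x → p x ≡ q x) → count p ≡ count q
count-cong {zero} p≗q = refl
count-cong {suc n} {p} {q} p≗q
  rewrite count-suc p | count-suc q | p≗q zero | count-cong (p≗q ∘ suc) = refl

count-complement : ∀ {n} (p : Fin n → Bool) → count p + count (not ∘ p) ≡ n
count-complement {zero} p = refl
count-complement {suc n} p rewrite count-suc p | count-suc (not ∘ p) with p zero
... | true  = cong suc (count-complement (p ∘ suc))
... | false = trans (+-suc _ _) (cong suc (count-complement (p ∘ suc)))

count-none : ∀ {n} (p : Fin n → Bool) → (∀ x → p x ≡ false) → count p ≡ 0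
count-none {zero} p none = refl
count-none {suc n} p none rewrite count-suc p | none zero = count-none (p ∘ suc) (none ∘ suc)

_∖_ : ∀ {n} → (Fin n → Bool) → Fin n → Fin n → Bool
(p ∖ a) x = p x ∧ not ⌊ x ≟ a ⌋

∖-sound : ∀ {n} (p : Fin n → Bool) {a x} → (p ∖ a) x ≡ true → p x ≡ true × x ≢ a
∖-sound p {a} {x} px∖a with p x | x ≟ a
... | true  | no x≢a = refl , x≢a
∖-sound p () | true  | yes _
∖-sound p () | false | _

∖-complete : ∀ {n} (p : Fin n → Bool) {a x} → p x ≡ true → x ≢ a → (p ∖ a) x ≡ true
∖-complete p {a} {x} px x≢a rewrite px | ⌊⌋-no (x ≟ a) x≢a = refl

count-remove : ∀ {n} (p : Fin n → Bool) {a} → p a ≡ true → count p ≡ suc (count (p ∖ a))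
count-remove {suc n} p {zero} pa rewrite count-suc p | count-suc (p ∖ zero) | pa =
  cong suc (count-cong (λ x → sym (∧-identityʳ (p (suc x)))))
count-remove {suc n} p {suc a} pa
  rewrite count-suc p | count-suc (p ∖ suc a) | count-remove (p ∘ suc) pa | ∧-identityʳ (p zero)
        | count-cong {p = (p ∖ suc a) ∘ suc} {q = (p ∘ suc) ∖ a}
            (λ x → cong (λ b → p (suc x) ∧ not b) (⌊⌋-map′ _ _ (x ≟ a)))
  with p zero
... | true  = refl
... | false = refl

count-≤-length : ∀ {n} (p : Fin n → Bool) (xs : List (Fin n)) →
  (∀ {x} → p x ≡ true → x ∈ xs) → count p ≤ length xs
count-≤-length p [] ⊆[] = ≤-reflexive (count-none p none)
  where
  none : ∀ x → p x ≡ false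
  none x with p x in px
  ... | true  with () ← ⊆[] px
  ... | false = refl
count-≤-length p (a ∷ as) ⊆a∷as with p a in pa
... | true  rewrite count-remove p pa = s≤s (count-≤-length (p ∖ a) as ⊆as)
  where
  ⊆as : ∀ {x} → (p ∖ a) x ≡ true → x ∈ as
  ⊆as px∖a with px , x≢a ← ∖-sound p px∖a with ⊆a∷as px
  ... | here x≡a = ⊥-elim (x≢a x≡a)
  ... | there x∈as = x∈as
... | false = m≤n⇒m≤1+n (count-≤-length p as ⊆as)
  where
  ⊆as : ∀ {x} → p x ≡ true → x ∈ as
  ⊆as px with ⊆a∷as px
  ... | here refl with () ← trans (sym pa) px
  ... | there x∈as = x∈as

length-≤-count : ∀ {n} (p : Fin n → Bool) {xs : List (Fin n)} →
  Unique xs → (∀ {x} → x ∈ xs → p x ≡ true) → length xs ≤ count p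
length-≤-count p [] xs⊆p = z≤n
length-≤-count p {a ∷ as} (a∉as ∷ as-unique) a∷as⊆p
  rewrite count-remove p (a∷as⊆p (here refl)) =
  s≤s (length-≤-count (p ∖ a) as-unique
        (λ x∈as → ∖-complete p (a∷as⊆p (there x∈as)) (λ x≡a → All.lookup a∉as x∈as (sym x≡a))))

count-positive : ∀ {n} (p : Fin n → Bool) {a} → p a ≡ true → 1 ≤ count p
count-positive p pa rewrite count-remove p pa = s≤s z≤n

closedNbhd-self : ∀ {n} (G : Graph n) v → inClosedNbhd G v v ≡ true
closedNbhd-self G v rewrite ⌊⌋-yes (v ≟ v) refl = refl

module _ {n k : ℕ} (G : Graph n) where

  classSize-≤-length : ∀ (c : Fin n → Fin k) i (xs : List (Fin n)) →
    (∀ {x} → c x ≡ i → x ∈ xs) → classSize c i ≤ length xs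
  classSize-≤-length c i xs ⊆xs = count-≤-length (inClass c i) xs (λ {x} → ⊆xs ∘ ⌊⌋-sound (c x ≟ i))

  small-class-majority-dominated : ∀ (c : Fin n → Fin k) i {w y} →
    classSize c i ≤ 2 → c y ≡ i → inClosedNbhd G w y ≡ true →
    2 * nbhdInClass G c w i ≥ classSize c i
  small-class-majority-dominated c i {w} {y} small cy≡i y∈N[w] =
    ≤-trans small (*-monoʳ-≤ 2 (count-positive (λ u → inClosedNbhd G w u ∧ inClass c i u) y∈N[w]∩C))
    where
    y∈N[w]∩C : (inClosedNbhd G w y ∧ inClass c i y) ≡ true
    y∈N[w]∩C rewrite y∈N[w] | ⌊⌋-yes (c y ≟ i) cy≡i = refl

  recolour : (Fin n → Fin k) → Fin n → Fin k → Fin n → Fin k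
  recolour c u i z = if ⌊ z ≟ u ⌋ then i else c z

  module _ (c : Fin n → Fin k) (u : Fin n) (i : Fin k) where

    recolour-at : ∀ {z} → z ≡ u → recolour c u i z ≡ i
    recolour-at {z} z≡u rewrite ⌊⌋-yes (z ≟ u) z≡u = refl

    recolour-elsewhere : ∀ {z} → z ≢ u → recolour c u i z ≡ c z
    recolour-elsewhere {z} z≢u rewrite ⌊⌋-no (z ≟ u) z≢u = refl

    recolour-proper : IsProperColoring G c → (∀ y → adj G u y ≡ true → c y ≢ i) →
      IsProperColoring G (recolour c u i)
    recolour-proper proper avoid x y xy e = cases (x ≟ u) (y ≟ u)
      where
      cases : Dec (x ≡ u) → Dec (y ≡ u) → ⊥
      cases (yes x≡u) (yes y≡u) with () ←
        trans (sym (irrefl G u)) (subst₂ (λ a b → adj G a b ≡ true) x≡u y≡u xy)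
      cases (yes x≡u) (no y≢u) =
        avoid y (subst (λ a → adj G a y ≡ true) x≡u xy)
          (trans (sym (recolour-elsewhere y≢u)) (trans (sym e) (recolour-at x≡u)))
      cases (no x≢u) (yes y≡u) =
        avoid x (trans (Graph.sym G u x) (subst (λ b → adj G x b ≡ true) y≡u xy))
          (trans (sym (recolour-elsewhere x≢u)) (trans e (recolour-at y≡u)))
      cases (no x≢u) (no y≢u) =
        proper x y xy (trans (sym (recolour-elsewhere x≢u)) (trans e (recolour-elsewhere y≢u)))

    recolour-surjective : Surjective _≡_ _≡_ c → ∀ {x₀} → x₀ ≢ u → c x₀ ≡ c u →
      Surjective _≡_ _≡_ (recolour c u i)
    recolour-surjective surj {x₀} x₀≢u cx₀≡cu j with x , cx≡j ← surj j with x ≟ u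
    ... | no x≢u  = x , λ { refl → trans (recolour-elsewhere x≢u) (cx≡j refl) }
    ... | yes refl = x₀ , λ { refl → trans (recolour-elsewhere x₀≢u) (trans cx₀≡cu (cx≡j refl)) }

module NearlyUniversal {n : ℕ} (G : Graph n) (v : Fin n) (deg : degree G v ≥ n ∸ 2) where

  NonNeighbour : Fin n → Set
  NonNeighbour x = x ≢ v × adj G v x ≡ false

  non-neighbour-unique : ∀ {x y} → NonNeighbour x → NonNeighbour y → x ≡ y
  non-neighbour-unique {x} {y} (x≢v , vx) (y≢v , vy) with x ≟ y
  ... | yes x≡y = x≡y
  ... | no x≢y  = ⊥-elim (<-irrefl refl (≤-trans too-many (m≤n+m∸n n 2)))
    where
    distinct : Unique (v ∷ x ∷ y ∷ [])
    distinct = ((x≢v ∘ sym) ∷ (y≢v ∘ sym) ∷ []) ∷ (x≢y ∷ []) ∷ [] ∷ []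
    outside : ∀ {z} → z ∈ v ∷ x ∷ y ∷ [] → not (adj G v z) ≡ true
    outside (here refl)                 = cong not (irrefl G v)
    outside (there (here refl))         = cong not vx
    outside (there (there (here refl))) = cong not vy
    too-many : 3 + (n ∸ 2) ≤ n
    too-many = subst₂ _≤_ (+-comm (n ∸ 2) 3) (count-complement (adj G v))
      (+-mono-≤ deg (length-≤-count (not ∘ adj G v) distinct outside))

  v-in-closedNbhd : ∀ {w} → ¬ NonNeighbour w → inClosedNbhd G w v ≡ true
  v-in-closedNbhd {w} w-adjacent with v ≟ w
  ... | yes _ = refl
  ... | no v≢w with adj G v w in vw
  ...   | true  = trans (Graph.sym G w v) vw
  ...   | false = ⊥-elim (w-adjacent ((v≢w ∘ sym) , refl))

  class-of-v : ∀ {k} {c : Fin n → Fin k} → IsProperColoring G c →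
    ∀ {x} → c x ≡ c v → x ≡ v ⊎ NonNeighbour x
  class-of-v {c = c} proper {x} cx≡cv with x ≟ v
  ... | yes x≡v = inj₁ x≡v
  ... | no x≢v with adj G v x in vx
  ...   | true  = ⊥-elim (proper v x vx (sym cx≡cv))
  ...   | false = inj₂ (x≢v , refl)

  non-neighbour? : ∀ x → Dec (NonNeighbour x)
  non-neighbour? x = ¬? (x ≟ v) ×-dec (adj G v x ≟ᵇ false)

  module _ {k : ℕ} {c : Fin n → Fin k} (colouring : IsColoringWithClasses G c) where

    majority-if-no-non-neighbour : (∀ x → ¬ NonNeighbour x) →
      Σ (Fin n → Fin k) (IsMajorityDominatorColoring G)
    majority-if-no-non-neighbour none = c , colouring , λ w →
      c v , small-class-majority-dominated G c (c v) (m≤n⇒m≤1+n small) refl (v-in-closedNbhd (none w))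
      where
      small : classSize c (c v) ≤ 1
      small = classSize-≤-length G c (c v) (v ∷ []) λ cx≡cv →
        [ here , (λ nx → ⊥-elim (none _ nx)) ]′ (class-of-v (proj₁ colouring) cx≡cv)

    module _ {u : Fin n} (nu : NonNeighbour u) where

      adjacent-to-v : ∀ {w} → w ≢ u → ¬ NonNeighbour w
      adjacent-to-v w≢u nw = w≢u (non-neighbour-unique nw nu)

      class-of-v-small : ∀ {d : Fin n → Fin k} → IsProperColoring G d → classSize d (d v) ≤ 2
      class-of-v-small {d} proper = classSize-≤-length G d (d v) (v ∷ u ∷ []) λ dx≡dv →
        [ here , (λ nx → there (here (non-neighbour-unique nx nu))) ]′ (class-of-v proper dx≡dv)

      majority-if-alone : (∀ x → x ≢ u → c x ≢ c u) →
        Σ (Fin n → Fin k) (IsMajorityDominatorColoring G)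
      majority-if-alone alone = c , colouring , pick
        where
        class-of-u : ∀ {x} → c x ≡ c u → x ∈ u ∷ []
        class-of-u {x} cx≡cu with x ≟ u
        ... | yes x≡u = here x≡u
        ... | no x≢u  = ⊥-elim (alone x x≢u cx≡cu)
        pick : ∀ w → ∃ λ i → 2 * nbhdInClass G c w i ≥ classSize c i
        pick w with w ≟ u
        ... | yes refl = c u , small-class-majority-dominated G c (c u)
          (m≤n⇒m≤1+n (classSize-≤-length G c (c u) (u ∷ []) class-of-u)) refl (closedNbhd-self G u)
        ... | no w≢u = c v , small-class-majority-dominated G c (c v)
          (class-of-v-small (proj₁ colouring)) refl (v-in-closedNbhd (adjacent-to-v w≢u))

      -- Giving u the colour of v keeps the colouring proper, since the
      -- neighbours of u are outside the class of v, which lies in {v, u}.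
      majority-if-shared : ∀ {x₀} → x₀ ≢ u → c x₀ ≡ c u →
        Σ (Fin n → Fin k) (IsMajorityDominatorColoring G)
      majority-if-shared x₀≢u cx₀≡cu = d , (d-proper , d-surjective) , pick
        where
        d : Fin n → Fin k
        d = recolour G c u (c v)
        avoid : ∀ y → adj G u y ≡ true → c y ≢ c v
        avoid y uy cy≡cv with class-of-v (proj₁ colouring) cy≡cv
        ... | inj₁ refl with () ← trans (sym (proj₂ nu)) (trans (Graph.sym G v u) uy)
        ... | inj₂ ny with refl ← non-neighbour-unique ny nu with () ← trans (sym (irrefl G y)) uy
        d-proper : IsProperColoring G d
        d-proper = recolour-proper G c u (c v) (proj₁ colouring) avoid
        d-surjective : Surjective _≡_ _≡_ d
        d-surjective = recolour-surjective G c u (c v) (proj₂ colouring) x₀≢u cx₀≡cu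
        du≡dv : d u ≡ d v
        du≡dv = trans (recolour-at G c u (c v) refl)
                      (sym (recolour-elsewhere G c u (c v) (proj₁ nu ∘ sym)))
        pick : ∀ w → ∃ λ i → 2 * nbhdInClass G d w i ≥ classSize d i
        pick w with w ≟ u
        ... | yes refl = d v , small-class-majority-dominated G d (d v)
          (class-of-v-small d-proper) du≡dv (closedNbhd-self G u)
        ... | no w≢u = d v , small-class-majority-dominated G d (d v)
          (class-of-v-small d-proper) refl (v-in-closedNbhd (adjacent-to-v w≢u))

    majorityDominatorColoring : Σ (Fin n → Fin k) (IsMajorityDominatorColoring G)
    majorityDominatorColoring with any? non-neighbour?
    ... | no none = majority-if-no-non-neighbour (λ x nx → none (x , nx))
    ... | yes (u , nu) with any? (λ x → ¬? (x ≟ u) ×-dec (c x ≟ c u))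
    ...   | no alone = majority-if-alone nu (λ x x≢u cx≡cu → alone (x , x≢u , cx≡cu))
    ...   | yes (x₀ , x₀≢u , cx₀≡cu) = majority-if-shared nu x₀≢u cx₀≡cu

proposition2p5 : (n : ℕ) (G : Graph n) → Connected G →
    MaxDegreeAtLeast G (n ∸ 2) →
    (k : ℕ) → IsChromaticNumber G k → IsMajorityDominatorChromaticNumber G k
proposition2p5 n G _ (v , deg) k ((c , colouring) , fewer-impossible) =
  NearlyUniversal.majorityDominatorColoring G v deg colouring ,
  λ j j<k (d , colouring-d , _) → fewer-impossible j j<k (d , colouring-d)
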